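{- Let $G$ be a graph with maximum degree $\Delta(G)\le 2$ and let $D$ be an orientation of $G$ on $n$ vertices. Then $D$ has an arrangement $(v_1,\dots,v_n)$ such that for every $1\le k\le n-1$, the number of edges from $\{v_1,\dots,v_k\}$ to $\{v_{k+1},\dots,v_n\}$ equals $\max\{|E(X,Y)| : \{X,Y\}\text{ a partition of }V(D),\ |X|=k\}$ (i.e., $D$ has a maximum arrangement).
   Context: An orientation of $G$ replaces each edge $\{u,v\}$ by exactly one of $(u,v),(v,u)$. $E(X,Y)$ is the set of edges with tail in $X$ and head in $Y$. An arrangement is a bijection $\pi:V(D)\to\{1,\dots,n\}$, written $(v_1,\dots,v_n)$ when $\pi(v_i)=i$. -}

module Defs where

open import Data.Nat using (ℕ; zero; suc; _+_; _≤_; _<ᵇ_)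
open import Data.Fin using (Fin; toℕ) renaming (zero to fzero; suc to fsuc)
open import Data.Bool using (Bool; true; false; _∧_; _∨_; not; if_then_else_)
open import Data.Product using (Σ; _×_; _,_)
open import Relation.Binary.PropositionalEquality using (_≡_)
open import Function.Bundles using (Bijection; _⤖_)

∑ : ∀ {n} → (Fin n → ℕ) → ℕ
∑ {zero}  f = 0
∑ {suc n} f = f fzero + ∑ (λ i → f (fsuc i))

record Graph (n : ℕ) : Set where
  field
    adj       : Fin n → Fin n → Bool
    irrefl    : ∀ v → adj v v ≡ false
    symmetric : ∀ u v → adj u v ≡ adj v u

-- A digraph on vertex set Fin n: arc u → v iff arc u v ≡ true.
Digraph : ℕ → Set
Digraph n = Fin n → Fin n → Bool

Subset : ℕ → Set
Subset n = Fin n → Bool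

∣_∣ : ∀ {n} → Subset n → ℕ
∣ X ∣ = ∑ (λ v → if X v then 1 else 0)

∁ : ∀ {n} → Subset n → Subset n
∁ X v = not (X v)

degree : ∀ {n} → Graph n → Fin n → ℕ
degree G v = ∑ (λ u → if Graph.adj G v u then 1 else 0)

MaxDegreeAtMost : ∀ {n} → Graph n → ℕ → Set
MaxDegreeAtMost G d = ∀ v → degree G v ≤ d

IsOrientation : ∀ {n} → Digraph n → Graph n → Set
IsOrientation {n} D G =
  (∀ (u v : Fin n) → (D u v ∨ D v u) ≡ Graph.adj G u v) ×
  (∀ (u v : Fin n) → (D u v ∧ D v u) ≡ false)

∣E∣ : ∀ {n} → Digraph n → Subset n → Subset n → ℕ
∣E∣ D X Y = ∑ (λ u → ∑ (λ v → if D u v ∧ X u ∧ Y v then 1 else 0))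

-- m = max { |E(X,Y)| : {X,Y} a partition of V(D), |X| = k }
-- (partitions {X,Y} with |X| = k are given by X with |X| = k and Y = ∁ X)
IsMaxCut : ∀ {n} → Digraph n → ℕ → ℕ → Set
IsMaxCut {n} D k m =
  (Σ (Subset n) λ X → (∣ X ∣ ≡ k) × (∣E∣ D X (∁ X) ≡ m)) ×
  (∀ (X : Subset n) → ∣ X ∣ ≡ k → ∣E∣ D X (∁ X) ≤ m)

-- An arrangement: bijection π : V(D) → {1,…,n}, here 0-indexed as Fin n.
Arrangement : ℕ → Set
Arrangement n = Fin n ⤖ Fin n

-- {v_1,…,v_k} = vertices whose position (1-indexed) is ≤ k, i.e. 0-indexed < k
prefix : ∀ {n} → Arrangement n → ℕ → Subset n
prefix π k v = toℕ (Bijection.to π v) <ᵇ k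

IsMaximumArrangement : ∀ {n} → Digraph n → Arrangement n → Set
IsMaximumArrangement {n} D π =
  ∀ (k : ℕ) → 1 ≤ k → suc k ≤ n →
    IsMaxCut D k (∣E∣ D (prefix π k) (∁ (prefix π k)))

module Submission where

-- Let M be the largest value of the cut function f(Z) = |E(Z, V ∖ Z)|, let X be a smallest set with
-- f(X) = M, and let Y be a smallest set disjoint from X with f(V ∖ Y) = M. As every vertex has total
-- degree at most 2, minimality forces X to be independent, to avoid sinks and to contain every vertex of
-- out-degree 2: removing the head of an arc inside X, removing a sink, or trading an outside source of
-- out-degree 2 for its two heads never lowers the cut. Symmetrically, Y has these properties in the
-- reversed digraph. Arrange the vertices in five layers: out-degree-2 vertices, the rest of X, the
-- vertices outside X ∪ Y, the rest of Y, in-degree-2 vertices. A prefix P inside X is independent, so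
-- f(P) is its total out-degree, which meets the bound f(Z) ≤ min(2|Z|, |Z| + #{out-degree 2}) valid for
-- every Z. A prefix between X and V ∖ Y has f(P) ≥ M by submodularity of f. A prefix whose complement
-- lies in Y is the first case in the reversed digraph.

open import Defs
open import Data.Nat using (ℕ; zero; suc; _+_; _*_; _≤_; _<_; z≤n; s≤s; s≤s⁻¹; _<ᵇ_; _≡ᵇ_)
open import Data.Nat.Properties hiding (_≟_)
import Data.Nat.Properties as ℕ
open import Data.Unit using (⊤; tt)
open import Data.Fin using (Fin; toℕ; fromℕ<; punchOut) renaming (zero to fzero; suc to fsuc)
open import Data.Fin.Properties
  using (_≟_; toℕ<n; toℕ-fromℕ<; toℕ-injective; any?; all?; pigeonhole; punchOut-injective)
  renaming (<-irrefl to <ᶠ-irrefl; suc-injective to fsuc-injective)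
open import Data.Bool using (Bool; true; false; _∧_; _∨_; not; if_then_else_)
import Data.Bool.Properties as Bool
open import Data.Bool.Properties
  using (T-≡; not-involutive; ∧-comm; ∧-zeroʳ; ∧-identityʳ; ∨-identityʳ; ∨-zeroʳ)
open import Data.Product using (Σ; _×_; _,_; ∃; ∃₂)
open import Data.Sum using (_⊎_; inj₁; inj₂)
open import Data.Empty using (⊥; ⊥-elim)
open import Data.List using (List; [_]; _++_; map; filter)
open import Data.Vec.Functional using ([]; _∷_)
open import Data.List.Relation.Unary.Any using (here)
open import Data.List.Membership.Propositional using (_∈_)
open import Data.List.Membership.Propositional.Properties using (∈-map⁺; ∈-++⁺ˡ; ∈-++⁺ʳ; ∈-filter⁺)
open import Data.List.Relation.Unary.All using (lookup)
open import Data.List.Relation.Unary.All.Properties using (all-filter)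
open import Data.List.Extrema.Nat
  using (argmax; argmin; f[xs]≤f[argmax]; f[argmin]≤f[xs]; argmax-all; argmin-all)
open import Relation.Binary.Definitions using (tri<; tri≈; tri>)
open import Relation.Nullary using (¬_; Dec; yes; no; does)
open import Relation.Nullary.Decidable using (_×-dec_; _→-dec_)
open import Relation.Unary using (Decidable)
open import Relation.Binary.PropositionalEquality
  using (_≡_; _≢_; _≗_; refl; sym; trans; cong; cong₂; subst; module ≡-Reasoning)
open import Function using (case_of_)
open import Function.Bundles using (Bijection; _⤖_; mk⤖; Equivalence)
open import Function.Properties.Bijection using (⤖⇒↔)
import Algebra.Properties.CommutativeMonoid.Sum as CommutativeMonoidSum

module ℕ-Sum = CommutativeMonoidSum +-0-commutativeMonoid

⟦_⟧ : Bool → ℕ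
⟦ b ⟧ = if b then 1 else 0

⟦⟧≤1 : ∀ b → ⟦ b ⟧ ≤ 1
⟦⟧≤1 true  = s≤s z≤n
⟦⟧≤1 false = z≤n

⟦∧⟧≤ : ∀ a b → ⟦ a ∧ b ⟧ ≤ ⟦ a ⟧
⟦∧⟧≤ true  b = ⟦⟧≤1 b
⟦∧⟧≤ false b = z≤n

∑-cong : ∀ {n} {f g : Fin n → ℕ} → f ≗ g → ∑ f ≡ ∑ g
∑-cong {zero}  f≗g = refl
∑-cong {suc n} f≗g = cong₂ _+_ (f≗g fzero) (∑-cong (λ i → f≗g (fsuc i)))

∑-mono : ∀ {n} {f g : Fin n → ℕ} → (∀ i → f i ≤ g i) → ∑ f ≤ ∑ g
∑-mono {zero}  f≤g = z≤n
∑-mono {suc n} f≤g = +-mono-≤ (f≤g fzero) (∑-mono (λ i → f≤g (fsuc i)))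

∑-mono-< : ∀ {n} {f g : Fin n → ℕ} (a : Fin n) → (∀ i → f i ≤ g i) → f a < g a → ∑ f < ∑ g
∑-mono-< {suc n} fzero    f≤g fa<ga = +-mono-<-≤ fa<ga (∑-mono (λ i → f≤g (fsuc i)))
∑-mono-< {suc n} (fsuc a) f≤g fa<ga = +-mono-≤-< (f≤g fzero) (∑-mono-< a (λ i → f≤g (fsuc i)) fa<ga)

∑-zero : ∀ n → ∑ {n} (λ _ → 0) ≡ 0
∑-zero zero    = refl
∑-zero (suc n) = ∑-zero n

∑-one : ∀ n → ∑ {n} (λ _ → 1) ≡ n
∑-one zero    = refl
∑-one (suc n) = cong suc (∑-one n)

∑-term≤ : ∀ {n} (f : Fin n → ℕ) (a : Fin n) → f a ≤ ∑ f
∑-term≤ f fzero    = m≤m+n _ _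
∑-term≤ f (fsuc a) = ≤-trans (∑-term≤ (λ i → f (fsuc i)) a) (m≤n+m _ (f fzero))

∑-point : ∀ {n} (a : Fin n) (c : ℕ) → ∑ (λ i → if does (i ≟ a) then c else 0) ≡ c
∑-point {suc n} fzero    c = trans (cong (c +_) (∑-zero n)) (+-identityʳ c)
∑-point {suc n} (fsuc a) c = ∑-point a c

∑-if : ∀ {n} (b : Bool) (g : Fin n → ℕ) → ∑ (λ i → if b then g i else 0) ≡ (if b then ∑ g else 0)
∑-if         true  g = refl
∑-if {n = n} false g = ∑-zero n

∑≡sum : ∀ {n} (f : Fin n → ℕ) → ∑ f ≡ ℕ-Sum.sum f
∑≡sum {zero}  f = refl
∑≡sum {suc n} f = cong (f fzero +_) (∑≡sum (λ i → f (fsuc i)))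

∑-distrib-+ : ∀ {n} (f g : Fin n → ℕ) → ∑ (λ i → f i + g i) ≡ ∑ f + ∑ g
∑-distrib-+ f g = begin
  ∑ (λ i → f i + g i)                ≡⟨ ∑≡sum (λ i → f i + g i) ⟩
  ℕ-Sum.sum (λ i → f i + g i)        ≡⟨ ℕ-Sum.∑-distrib-+ f g ⟩
  ℕ-Sum.sum f + ℕ-Sum.sum g          ≡⟨ sym (cong₂ _+_ (∑≡sum f) (∑≡sum g)) ⟩
  ∑ f + ∑ g                          ∎
  where open ≡-Reasoning

∑-comm : ∀ {m n} (f : Fin m → Fin n → ℕ) → ∑ (λ i → ∑ (λ j → f i j)) ≡ ∑ (λ j → ∑ (λ i → f i j))
∑-comm f = begin
  ∑ (λ i → ∑ (λ j → f i j))                  ≡⟨ ∑-cong (λ i → ∑≡sum (f i)) ⟩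
  ∑ (λ i → ℕ-Sum.sum (f i))                  ≡⟨ ∑≡sum (λ i → ℕ-Sum.sum (f i)) ⟩
  ℕ-Sum.sum (λ i → ℕ-Sum.sum (f i))          ≡⟨ ℕ-Sum.∑-comm f ⟩
  ℕ-Sum.sum (λ j → ℕ-Sum.sum (λ i → f i j))  ≡⟨ sym (∑≡sum (λ j → ℕ-Sum.sum (λ i → f i j))) ⟩
  ∑ (λ j → ℕ-Sum.sum (λ i → f i j))          ≡⟨ sym (∑-cong (λ j → ∑≡sum (λ i → f i j))) ⟩
  ∑ (λ j → ∑ (λ i → f i j))                  ∎
  where open ≡-Reasoning

∑∑-distrib-+ : ∀ {n} (f g : Fin n → Fin n → ℕ) →
               ∑ (λ u → ∑ (λ v → f u v + g u v)) ≡ ∑ (λ u → ∑ (f u)) + ∑ (λ u → ∑ (g u))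
∑∑-distrib-+ f g =
  trans (∑-cong (λ u → ∑-distrib-+ (f u) (g u))) (∑-distrib-+ (λ u → ∑ (f u)) (λ u → ∑ (g u)))

∑-permute : ∀ {n} (π : Fin n ⤖ Fin n) (f : Fin n → ℕ) → ∑ (λ v → f (Bijection.to π v)) ≡ ∑ f
∑-permute π f = begin
  ∑ (λ v → f (Bijection.to π v))          ≡⟨ ∑≡sum (λ v → f (Bijection.to π v)) ⟩
  ℕ-Sum.sum (λ v → f (Bijection.to π v))  ≡⟨ sym (ℕ-Sum.sum-permute f (⤖⇒↔ π)) ⟩
  ℕ-Sum.sum f                              ≡⟨ sym (∑≡sum f) ⟩
  ∑ f                                      ∎
  where open ≡-Reasoning

≡ᵇ2⇒≡2 : ∀ m → (m ≡ᵇ 2) ≡ true → m ≡ 2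
≡ᵇ2⇒≡2 2 _ = refl
≡ᵇ2⇒≡2 0 ()
≡ᵇ2⇒≡2 1 ()
≡ᵇ2⇒≡2 (suc (suc (suc m))) ()

≤2⇒≤1+⟦≡ᵇ2⟧ : ∀ m → m ≤ 2 → m ≤ 1 + ⟦ m ≡ᵇ 2 ⟧
≤2⇒≤1+⟦≡ᵇ2⟧ 0 _ = z≤n
≤2⇒≤1+⟦≡ᵇ2⟧ 1 _ = ≤-refl
≤2⇒≤1+⟦≡ᵇ2⟧ 2 _ = ≤-refl
≤2⇒≤1+⟦≡ᵇ2⟧ (suc (suc (suc m))) (s≤s (s≤s ()))

1≤≤2⇒≡1+⟦≡ᵇ2⟧ : ∀ m → 1 ≤ m → m ≤ 2 → m ≡ 1 + ⟦ m ≡ᵇ 2 ⟧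
1≤≤2⇒≡1+⟦≡ᵇ2⟧ 1 _ _ = refl
1≤≤2⇒≡1+⟦≡ᵇ2⟧ 2 _ _ = refl
1≤≤2⇒≡1+⟦≡ᵇ2⟧ (suc (suc (suc m))) _ (s≤s (s≤s ()))

count< : ∀ {n} (b : Fin n → Bool) (a : Fin n) → b a ≡ false → ∑ (λ i → ⟦ b i ⟧) < n
count< {n} b a ba≡false = <-≤-trans
  (∑-mono-< a (λ i → ⟦⟧≤1 (b i)) (subst (λ x → ⟦ x ⟧ < 1) (sym ba≡false) (s≤s z≤n)))
  (≤-reflexive (∑-one n))

count-witness : ∀ {n} (b : Fin n → Bool) → 1 ≤ ∑ (λ i → ⟦ b i ⟧) → ∃ λ i → b i ≡ true
count-witness {suc n} b p with b fzero in b0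
... | true  = fzero , b0
... | false = let i , bi = count-witness (λ i → b (fsuc i)) p in fsuc i , bi

count-two-witnesses : ∀ {n} (b : Fin n → Bool) → 2 ≤ ∑ (λ i → ⟦ b i ⟧) →
                      ∃₂ λ i j → i ≢ j × b i ≡ true × b j ≡ true
count-two-witnesses {suc n} b p with b fzero in b0
... | true  = let j , bj = count-witness (λ i → b (fsuc i)) (s≤s⁻¹ p)
              in fzero , fsuc j , (λ ()) , b0 , bj
... | false = let i , j , i≢j , bi , bj = count-two-witnesses (λ i → b (fsuc i)) p
              in fsuc i , fsuc j , (λ e → i≢j (fsuc-injective e)) , bi , bj

_⊆_ : ∀ {n} → Subset n → Subset n → Set
X ⊆ Y = ∀ v → X v ≡ true → Y v ≡ true

_⊆?_ : ∀ {n} (X Y : Subset n) → Dec (X ⊆ Y)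
X ⊆? Y = all? (λ v → (X v Bool.≟ true) →-dec (Y v Bool.≟ true))

⊆-respˡ-≗ : ∀ {n} {X X′ Y : Subset n} → X ≗ X′ → X ⊆ Y → X′ ⊆ Y
⊆-respˡ-≗ X≗X′ X⊆Y v X′v = X⊆Y v (trans (X≗X′ v) X′v)

_∪_ _∩_ : ∀ {n} → Subset n → Subset n → Subset n
(X ∪ Y) v = X v ∨ Y v
(X ∩ Y) v = X v ∧ Y v

insert remove : ∀ {n} → Fin n → Subset n → Subset n
insert a Z v = Z v ∨ does (v ≟ a)
remove a Z v = Z v ∧ not (does (v ≟ a))

insert-∈ : ∀ {n} (a : Fin n) (Z : Subset n) → insert a Z a ≡ true
insert-∈ a Z with a ≟ a
... | yes _   = ∨-zeroʳ (Z a)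
... | no a≢a = ⊥-elim (a≢a refl)

remove-insert : ∀ {n} (a : Fin n) (Z : Subset n) → Z a ≡ false → remove a (insert a Z) ≗ Z
remove-insert a Z Za v with v ≟ a
... | yes refl rewrite Za = refl
... | no _     = trans (∧-identityʳ _) (∨-identityʳ (Z v))

insert-⊇ : ∀ {n} (a : Fin n) (Z : Subset n) → Z ⊆ insert a Z
insert-⊇ a Z v Zv rewrite Zv = refl

insert-⊆ : ∀ {n} (a : Fin n) (Z A : Subset n) → Z ⊆ A → A a ≡ true → insert a Z ⊆ A
insert-⊆ a Z A Z⊆A Aa v _ with Z v in Zv | v ≟ a
... | true  | _        = Z⊆A v Zv
... | false | yes refl = Aa

remove-⊆ : ∀ {n} (a : Fin n) (Z : Subset n) → remove a Z ⊆ Z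
remove-⊆ a Z v Z'v with Z v
... | true = refl

remove-∈ : ∀ {n} (a : Fin n) (Z : Subset n) {v} → Z v ≡ true → v ≢ a → remove a Z v ≡ true
remove-∈ a Z {v} Zv v≢a with v ≟ a
... | yes v≡a = ⊥-elim (v≢a v≡a)
... | no _    rewrite Zv = refl

∣∣-cong : ∀ {n} {Y Z : Subset n} → Y ≗ Z → ∣ Y ∣ ≡ ∣ Z ∣
∣∣-cong Y≗Z = ∑-cong (λ v → cong ⟦_⟧ (Y≗Z v))

∣∣+∣∁∣ : ∀ {n} (Z : Subset n) → ∣ Z ∣ + ∣ ∁ Z ∣ ≡ n
∣∣+∣∁∣ {n} Z = trans (sym (∑-distrib-+ (λ v → ⟦ Z v ⟧) (λ v → ⟦ not (Z v) ⟧)))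
                     (trans (∑-cong (λ v → ⟦b⟧+⟦¬b⟧ (Z v))) (∑-one n))
  where
  ⟦b⟧+⟦¬b⟧ : ∀ b → ⟦ b ⟧ + ⟦ not b ⟧ ≡ 1
  ⟦b⟧+⟦¬b⟧ true  = refl
  ⟦b⟧+⟦¬b⟧ false = refl

∣∁∣-cong : ∀ {n} {Y Z : Subset n} → ∣ Y ∣ ≡ ∣ Z ∣ → ∣ ∁ Y ∣ ≡ ∣ ∁ Z ∣
∣∁∣-cong {Y = Y} {Z} ∣Y∣≡∣Z∣ = +-cancelˡ-≡ ∣ Z ∣ _ _
  (trans (cong (_+ ∣ ∁ Y ∣) (sym ∣Y∣≡∣Z∣)) (trans (∣∣+∣∁∣ Y) (sym (∣∣+∣∁∣ Z))))

∣remove∣ : ∀ {n} (a : Fin n) (Z : Subset n) → Z a ≡ true → ∣ Z ∣ ≡ suc ∣ remove a Z ∣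
∣remove∣ a Z Za = begin
  ∣ Z ∣                                                          ≡⟨ ∑-cong split ⟩
  ∑ (λ v → ⟦ remove a Z v ⟧ + (if does (v ≟ a) then 1 else 0))  ≡⟨ ∑-distrib-+ (λ v → ⟦ remove a Z v ⟧) _ ⟩
  ∣ remove a Z ∣ + ∑ (λ v → if does (v ≟ a) then 1 else 0)       ≡⟨ cong (∣ remove a Z ∣ +_) (∑-point a 1) ⟩
  ∣ remove a Z ∣ + 1                                             ≡⟨ +-comm _ 1 ⟩
  suc ∣ remove a Z ∣                                             ∎
  where
  open ≡-Reasoning
  split : ∀ v → ⟦ Z v ⟧ ≡ ⟦ remove a Z v ⟧ + (if does (v ≟ a) then 1 else 0)
  split v with v ≟ a
  ... | yes refl rewrite Za = refl
  ... | no _     rewrite ∧-identityʳ (Z v) = sym (+-identityʳ _)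

∣insert∣ : ∀ {n} (a : Fin n) (Z : Subset n) → Z a ≡ false → ∣ insert a Z ∣ ≡ suc ∣ Z ∣
∣insert∣ a Z Za =
  trans (∣remove∣ a (insert a Z) (insert-∈ a Z)) (cong suc (∣∣-cong (remove-insert a Z Za)))

subsets : ∀ n → List (Subset n)
subsets zero    = [ [] ]
subsets (suc n) = map (false ∷_) (subsets n) ++ map (true ∷_) (subsets n)

∷-∈-subsets : ∀ {n} b {Y : Subset n} → Y ∈ subsets n → (b ∷ Y) ∈ subsets (suc n)
∷-∈-subsets false Y∈ = ∈-++⁺ˡ (∈-map⁺ (false ∷_) Y∈)
∷-∈-subsets true  Y∈ = ∈-++⁺ʳ _ (∈-map⁺ (true ∷_) Y∈)

subsets-complete : ∀ {n} (Z : Subset n) → ∃ λ Y → Y ∈ subsets n × Y ≗ Z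
subsets-complete {zero}  Z = [] , here refl , λ ()
subsets-complete {suc n} Z =
  let Y , Y∈ , Y≗ = subsets-complete (λ i → Z (fsuc i))
  in Z fzero ∷ Y , ∷-∈-subsets (Z fzero) Y∈ , λ { fzero → refl ; (fsuc i) → Y≗ i }

module _ {n} {Q : Subset n → Set} (Q? : Decidable Q) (Q-resp : ∀ {Y Z} → Y ≗ Z → Q Y → Q Z)
         (g : Subset n → ℕ) (g-resp : ∀ {Y Z} → Y ≗ Z → g Y ≡ g Z) where

  private
    candidates : List (Subset n)
    candidates = filter Q? (subsets n)

    candidate : ∀ Z → Q Z → ∃ λ Y → Y ∈ candidates × g Y ≡ g Z
    candidate Z QZ =
      let Y , Y∈ , Y≗Z = subsets-complete Z
      in Y , ∈-filter⁺ Q? Y∈ (Q-resp (λ v → sym (Y≗Z v)) QZ) , g-resp Y≗Z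

  maximise : ∀ {Z₀} → Q Z₀ → ∃ λ X → Q X × (∀ Z → Q Z → g Z ≤ g X)
  maximise {Z₀} QZ₀ = argmax g Z₀ candidates , argmax-all g QZ₀ (all-filter Q? (subsets n)) , λ Z QZ →
    let Y , Y∈ , gY≡gZ = candidate Z QZ
    in ≤-trans (≤-reflexive (sym gY≡gZ)) (lookup (f[xs]≤f[argmax] {f = g} Z₀ candidates) Y∈)

  minimise : ∀ {Z₀} → Q Z₀ → ∃ λ X → Q X × (∀ Z → Q Z → g X ≤ g Z)
  minimise {Z₀} QZ₀ = argmin g Z₀ candidates , argmin-all g QZ₀ (all-filter Q? (subsets n)) , λ Z QZ →
    let Y , Y∈ , gY≡gZ = candidate Z QZ
    in ≤-trans (lookup (f[argmin]≤f[xs] {f = g} Z₀ candidates) Y∈) (≤-reflexive gY≡gZ)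

-- Arrangements sorted by a key

<ᵇ-true : ∀ {m k} → m < k → (m <ᵇ k) ≡ true
<ᵇ-true m<k = Equivalence.to T-≡ (<⇒<ᵇ m<k)

<ᵇ-true⁻¹ : ∀ {m k} → (m <ᵇ k) ≡ true → m < k
<ᵇ-true⁻¹ {m} {k} e = <ᵇ⇒< m k (Equivalence.from T-≡ e)

<ᵇ-irrefl : ∀ m → (m <ᵇ m) ≡ false
<ᵇ-irrefl zero    = refl
<ᵇ-irrefl (suc m) = <ᵇ-irrefl m

injective⇒surjective : ∀ {m} (p : Fin m → Fin m) → (∀ {u v} → p u ≡ p v → u ≡ v) → ∀ i → ∃ λ v → p v ≡ i
injective⇒surjective {suc m} p p-injective i with any? (λ v → p v ≟ i)
... | yes hit = hit
... | no miss with pigeonhole (n<1+n m) (λ v → punchOut {i = i} (λ i≡pv → miss (v , sym i≡pv)))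
... | a , b , a<b , eq = ⊥-elim (<ᶠ-irrefl (p-injective (punchOut-injective
        {i = i} (λ i≡pa → miss (a , sym i≡pa)) (λ i≡pb → miss (b , sym i≡pb)) eq)) a<b)

∣prefix∣ : ∀ {n} (π : Arrangement n) k → k ≤ n → ∣ prefix π k ∣ ≡ k
∣prefix∣ {n} π k k≤n = trans (∑-permute π (λ i → ⟦ toℕ i <ᵇ k ⟧)) (count n k k≤n)
  where
  count : ∀ n k → k ≤ n → ∑ {n} (λ i → ⟦ toℕ i <ᵇ k ⟧) ≡ k
  count zero    zero    _         = refl
  count (suc n) zero    _         = ∑-zero n
  count (suc n) (suc k) (s≤s k≤n) = cong suc (count n k k≤n)

module SortBy {n} (key : Fin n → ℕ) (key-injective : ∀ {u v} → key u ≡ key v → u ≡ v) where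

  position : Fin n → ℕ
  position v = ∑ (λ u → ⟦ key u <ᵇ key v ⟧)

  position<n : ∀ v → position v < n
  position<n v = count< (λ u → key u <ᵇ key v) v (<ᵇ-irrefl (key v))

  position-mono : ∀ {u v} → key u < key v → position u < position v
  position-mono {u} {v} ku<kv = ∑-mono-< u below-u at-u
    where
    at-u : ⟦ key u <ᵇ key u ⟧ < ⟦ key u <ᵇ key v ⟧
    at-u rewrite <ᵇ-irrefl (key u) | <ᵇ-true ku<kv = s≤s z≤n
    below-u : ∀ w → ⟦ key w <ᵇ key u ⟧ ≤ ⟦ key w <ᵇ key v ⟧
    below-u w with key w <ᵇ key u in kw<ku
    ... | false = z≤n
    ... | true  rewrite <ᵇ-true (<-trans (<ᵇ-true⁻¹ kw<ku) ku<kv) = ≤-refl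

  place : Fin n → Fin n
  place v = fromℕ< (position<n v)

  place-injective : ∀ {u v} → place u ≡ place v → u ≡ v
  place-injective {u} {v} eq with <-cmp (key u) (key v)
  ... | tri< ku<kv _ _ = ⊥-elim (<-irrefl same-position (position-mono ku<kv))
    where same-position = trans (sym (toℕ-fromℕ< _)) (trans (cong toℕ eq) (toℕ-fromℕ< _))
  ... | tri≈ _ ku≡kv _ = key-injective ku≡kv
  ... | tri> _ _ kv<ku = ⊥-elim (<-irrefl same-position (position-mono kv<ku))
    where same-position = trans (sym (toℕ-fromℕ< _)) (trans (cong toℕ (sym eq)) (toℕ-fromℕ< _))

  arrangement : Arrangement n
  arrangement = mk⤖ (place-injective , λ i → let v , pv≡i = injective⇒surjective place place-injective i
                                              in v , λ { refl → pv≡i })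

  prefix-downward : ∀ k {u v} → prefix arrangement k v ≡ true → key u < key v → prefix arrangement k u ≡ true
  prefix-downward k {u} {v} v∈ ku<kv = begin
    toℕ (place u) <ᵇ k  ≡⟨ cong (_<ᵇ k) (toℕ-fromℕ< _) ⟩
    position u <ᵇ k     ≡⟨ <ᵇ-true (<-trans (position-mono ku<kv) position-v<k) ⟩
    true                ∎
    where
    open ≡-Reasoning
    position-v<k : position v < k
    position-v<k = subst (_< k) (toℕ-fromℕ< _) (<ᵇ-true⁻¹ v∈)

module RankBy {n} (rank : Fin n → ℕ) where

  key : Fin n → ℕ
  key v = rank v * n + toℕ v

  key-mono : ∀ {u v} → rank u < rank v → key u < key v
  key-mono {u} {v} ru<rv = begin-strict
    rank u * n + toℕ u  <⟨ +-monoʳ-< (rank u * n) (toℕ<n u) ⟩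
    rank u * n + n      ≡⟨ +-comm (rank u * n) n ⟩
    suc (rank u) * n    ≤⟨ *-monoˡ-≤ n ru<rv ⟩
    rank v * n          ≤⟨ m≤m+n (rank v * n) (toℕ v) ⟩
    key v               ∎
    where open ≤-Reasoning

  key-injective : ∀ {u v} → key u ≡ key v → u ≡ v
  key-injective {u} {v} eq with <-cmp (rank u) (rank v)
  ... | tri< ru<rv _ _ = ⊥-elim (<-irrefl eq (key-mono ru<rv))
  ... | tri≈ _ ru≡rv _ = toℕ-injective (+-cancelˡ-≡ (rank u * n) (toℕ u) (toℕ v)
                           (trans eq (cong (λ r → r * n + toℕ v) (sym ru≡rv))))
  ... | tri> _ _ rv<ru = ⊥-elim (<-irrefl (sym eq) (key-mono rv<ru))

  open SortBy key key-injective public using (arrangement)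

  prefix-comparable : ∀ k j → (∀ v → prefix arrangement k v ≡ true → rank v < j)
                            ⊎ (∀ v → rank v < j → prefix arrangement k v ≡ true)
  prefix-comparable k j with any? (λ v → (prefix arrangement k v Bool.≟ true) ×-dec (j ≤? rank v))
  ... | yes (v , v∈ , j≤rv) = inj₂ λ u ru<j →
          SortBy.prefix-downward key key-injective k v∈ (key-mono (<-≤-trans ru<j j≤rv))
  ... | no none             = inj₁ λ v v∈ → ≰⇒> (λ j≤rv → none (v , v∈ , j≤rv))

-- Digraphs of maximum degree 2

outdeg indeg : ∀ {n} → Digraph n → Fin n → ℕ
outdeg D v = ∑ (λ u → ⟦ D v u ⟧)
indeg  D v = ∑ (λ u → ⟦ D u v ⟧)

fullOut : ∀ {n} → Digraph n → Subset n
fullOut D v = outdeg D v ≡ᵇ 2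

reverse : ∀ {n} → Digraph n → Digraph n
reverse D u v = D v u

record MaxDegree2 {n} (D : Digraph n) : Set where
  field
    loopless : ∀ v → D v v ≡ false
    degree≤2 : ∀ v → outdeg D v + indeg D v ≤ 2

  outdeg≤2 : ∀ v → outdeg D v ≤ 2
  outdeg≤2 v = ≤-trans (m≤m+n _ _) (degree≤2 v)

  outdeg≡2⇒indeg≡0 : ∀ v → outdeg D v ≡ 2 → indeg D v ≡ 0
  outdeg≡2⇒indeg≡0 v out≡2 =
    n≤0⇒n≡0 (+-cancelˡ-≤ 2 (indeg D v) 0 (subst (λ m → m + indeg D v ≤ 2) out≡2 (degree≤2 v)))

reverse-maxDegree2 : ∀ {n} {D : Digraph n} → MaxDegree2 D → MaxDegree2 (reverse D)
reverse-maxDegree2 {D = D} deg = record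
  { loopless = loopless
  ; degree≤2 = λ v → subst (_≤ 2) (+-comm (outdeg D v) (indeg D v)) (degree≤2 v)
  }
  where open MaxDegree2 deg

orientation-maxDegree2 : ∀ {n} (G : Graph n) (D : Digraph n) →
                         MaxDegreeAtMost G 2 → IsOrientation D G → MaxDegree2 D
orientation-maxDegree2 G D Δ≤2 (D∨Dᵀ≡adj , D∧Dᵀ≡false) = record
  { loopless = λ v → ∨-self-false (D v v) (trans (D∨Dᵀ≡adj v v) (Graph.irrefl G v))
  ; degree≤2 = λ v → ≤-trans (≤-reflexive (degree≡ v)) (Δ≤2 v)
  }
  where
  ∨-self-false : ∀ b → (b ∨ b) ≡ false → b ≡ false
  ∨-self-false false _ = refl

  ⟦∨⟧ : ∀ a b → (a ∧ b) ≡ false → ⟦ a ∨ b ⟧ ≡ ⟦ a ⟧ + ⟦ b ⟧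
  ⟦∨⟧ true  false _ = refl
  ⟦∨⟧ false b     _ = refl

  degree≡ : ∀ v → outdeg D v + indeg D v ≡ degree G v
  degree≡ v = begin
    outdeg D v + indeg D v              ≡⟨ sym (∑-distrib-+ (λ u → ⟦ D v u ⟧) (λ u → ⟦ D u v ⟧)) ⟩
    ∑ (λ u → ⟦ D v u ⟧ + ⟦ D u v ⟧)     ≡⟨ ∑-cong (λ u → sym (⟦∨⟧ (D v u) (D u v) (D∧Dᵀ≡false v u))) ⟩
    ∑ (λ u → ⟦ D v u ∨ D u v ⟧)         ≡⟨ ∑-cong (λ u → cong ⟦_⟧ (D∨Dᵀ≡adj v u)) ⟩
    degree G v                          ∎
    where open ≡-Reasoning

-- The cut function

cut : ∀ {n} → Digraph n → Subset n → ℕ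
cut D Z = ∣E∣ D Z (∁ Z)

arcsInto : ∀ {n} → Digraph n → Subset n → Fin n → ℕ
arcsInto D Z a = ∑ (λ u → ⟦ D u a ∧ Z u ⟧)

arcsOutOf : ∀ {n} → Digraph n → Fin n → Subset n → ℕ
arcsOutOf D a Y = ∑ (λ v → ⟦ D a v ∧ Y v ⟧)

outVolume : ∀ {n} → Digraph n → Subset n → ℕ
outVolume D Z = ∑ (λ u → if Z u then outdeg D u else 0)

Independent : ∀ {n} → Digraph n → Subset n → Set
Independent D Z = ∀ u v → Z u ≡ true → Z v ≡ true → D u v ≡ false

module _ {n} (D : Digraph n) where

  cut-cong : ∀ {Y Z} → Y ≗ Z → cut D Y ≡ cut D Z
  cut-cong Y≗Z = ∑-cong λ u → ∑-cong λ v →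
    cong₂ (λ x y → ⟦ D u v ∧ x ∧ not y ⟧) (Y≗Z u) (Y≗Z v)

  cut-reverse : ∀ Z → cut (reverse D) Z ≡ cut D (∁ Z)
  cut-reverse Z = trans (∑-comm (λ u v → ⟦ D v u ∧ Z u ∧ not (Z v) ⟧))
                        (∑-cong λ v → ∑-cong λ u → cong ⟦_⟧ (swap (D v u) (Z u) (Z v)))
    where
    swap : ∀ d zu zv → (d ∧ zu ∧ not zv) ≡ (d ∧ not zv ∧ not (not zu))
    swap d zu zv rewrite not-involutive zu = cong (d ∧_) (∧-comm zu (not zv))

  cut-∁∁ : ∀ Z → cut D (∁ (∁ Z)) ≡ cut D Z
  cut-∁∁ Z = cut-cong (λ v → not-involutive (Z v))

  cut-reverse-∁ : ∀ Z → cut (reverse D) (∁ Z) ≡ cut D Z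
  cut-reverse-∁ Z = trans (cut-reverse (∁ Z)) (cut-∁∁ Z)

  reverse-∁-maximum : ∀ X → (∀ Z → cut D Z ≤ cut D X) → ∀ Z → cut (reverse D) Z ≤ cut (reverse D) (∁ X)
  reverse-∁-maximum X maximum Z = begin
    cut (reverse D) Z      ≡⟨ cut-reverse Z ⟩
    cut D (∁ Z)            ≤⟨ maximum (∁ Z) ⟩
    cut D X                ≡⟨ sym (cut-reverse-∁ X) ⟩
    cut (reverse D) (∁ X)  ∎
    where open ≤-Reasoning

  cut-submodular : ∀ Y Z → cut D (Y ∪ Z) + cut D (Y ∩ Z) ≤ cut D Y + cut D Z
  cut-submodular Y Z = begin
    cut D (Y ∪ Z) + cut D (Y ∩ Z)
      ≡⟨ sym (∑∑-distrib-+ (crosses (Y ∪ Z)) (crosses (Y ∩ Z))) ⟩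
    ∑ (λ u → ∑ (λ v → crosses (Y ∪ Z) u v + crosses (Y ∩ Z) u v))
      ≤⟨ ∑-mono (λ u → ∑-mono (λ v → arc (D u v) (Y u) (Y v) (Z u) (Z v))) ⟩
    ∑ (λ u → ∑ (λ v → crosses Y u v + crosses Z u v))
      ≡⟨ ∑∑-distrib-+ (crosses Y) (crosses Z) ⟩
    cut D Y + cut D Z ∎
    where
    open ≤-Reasoning
    crosses : Subset n → Fin n → Fin n → ℕ
    crosses W u v = ⟦ D u v ∧ W u ∧ not (W v) ⟧
    arc : ∀ d yu yv zu zv → ⟦ d ∧ (yu ∨ zu) ∧ not (yv ∨ zv) ⟧ + ⟦ d ∧ (yu ∧ zu) ∧ not (yv ∧ zv) ⟧
                          ≤ ⟦ d ∧ yu ∧ not yv ⟧ + ⟦ d ∧ zu ∧ not zv ⟧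
    arc false _ _ _ _ = z≤n
    arc true  true  true  true  true  = ≤ᵇ⇒≤ _ _ _
    arc true  true  true  true  false = ≤ᵇ⇒≤ _ _ _
    arc true  true  true  false true  = ≤ᵇ⇒≤ _ _ _
    arc true  true  true  false false = ≤ᵇ⇒≤ _ _ _
    arc true  true  false true  true  = ≤ᵇ⇒≤ _ _ _
    arc true  true  false true  false = ≤ᵇ⇒≤ _ _ _
    arc true  true  false false true  = ≤ᵇ⇒≤ _ _ _
    arc true  true  false false false = ≤ᵇ⇒≤ _ _ _
    arc true  false true  true  true  = ≤ᵇ⇒≤ _ _ _
    arc true  false true  true  false = ≤ᵇ⇒≤ _ _ _
    arc true  false true  false true  = ≤ᵇ⇒≤ _ _ _
    arc true  false true  false false = ≤ᵇ⇒≤ _ _ _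
    arc true  false false true  true  = ≤ᵇ⇒≤ _ _ _
    arc true  false false true  false = ≤ᵇ⇒≤ _ _ _
    arc true  false false false true  = ≤ᵇ⇒≤ _ _ _
    arc true  false false false false = ≤ᵇ⇒≤ _ _ _

  cut-sandwich : ∀ {M} X P W → (∀ Z → cut D Z ≤ M) → cut D X ≡ M → cut D W ≡ M →
                 X ⊆ P → P ⊆ W → M ≤ cut D P
  cut-sandwich {M} X P W cut≤M cutX≡M cutW≡M X⊆P P⊆W = +-cancelʳ-≤ M M (cut D P) (begin
    M + M                          ≡⟨ sym (cong₂ _+_ (trans (cut-cong union) cutW≡M)
                                                     (trans (cut-cong intersection) cutX≡M)) ⟩
    cut D (P ∪ B) + cut D (P ∩ B)  ≤⟨ cut-submodular P B ⟩
    cut D P + cut D B              ≤⟨ +-monoʳ-≤ (cut D P) (cut≤M B) ⟩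
    cut D P + M                    ∎)
    where
    open ≤-Reasoning
    B : Subset n
    B = X ∪ (W ∩ ∁ P)
    union : P ∪ B ≗ W
    union v with P v in Pv | X v in Xv
    ... | true  | _     = sym (P⊆W v Pv)
    ... | false | false = ∧-identityʳ (W v)
    ... | false | true  = case trans (sym Pv) (X⊆P v Xv) of λ ()
    intersection : P ∩ B ≗ X
    intersection v with P v in Pv | X v in Xv
    ... | true  | x     = trans (cong (x ∨_) (∧-zeroʳ (W v))) (∨-identityʳ x)
    ... | false | false = refl
    ... | false | true  = case trans (sym Pv) (X⊆P v Xv) of λ ()

  cut-remove : (∀ v → D v v ≡ false) → ∀ a Z → Z a ≡ true →
               cut D Z + arcsInto D Z a ≡ cut D (remove a Z) + arcsOutOf D a (∁ Z)
  cut-remove loopless a Z Za = begin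
    cut D Z + arcsInto D Z a
      ≡⟨ cong (cut D Z +_) (sym (∑-cong λ u → ∑-point a ⟦ D u a ∧ Z u ⟧)) ⟩
    cut D Z + ∑ (λ u → ∑ (intoA u))
      ≡⟨ sym (∑∑-distrib-+ (crosses Z) intoA) ⟩
    ∑ (λ u → ∑ (λ v → crosses Z u v + intoA u v))
      ≡⟨ ∑-cong (λ u → ∑-cong (λ v → exchange u v)) ⟩
    ∑ (λ u → ∑ (λ v → crosses (remove a Z) u v + outOfA u v))
      ≡⟨ ∑∑-distrib-+ (crosses (remove a Z)) outOfA ⟩
    cut D (remove a Z) + ∑ (λ u → ∑ (outOfA u))
      ≡⟨ cong (cut D (remove a Z) +_) (∑-cong λ u → ∑-if (does (u ≟ a)) (λ v → ⟦ D a v ∧ not (Z v) ⟧)) ⟩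
    cut D (remove a Z) + ∑ (λ u → if does (u ≟ a) then arcsOutOf D a (∁ Z) else 0)
      ≡⟨ cong (cut D (remove a Z) +_) (∑-point a _) ⟩
    cut D (remove a Z) + arcsOutOf D a (∁ Z) ∎
    where
    open ≡-Reasoning
    crosses : Subset n → Fin n → Fin n → ℕ
    crosses W u v = ⟦ D u v ∧ W u ∧ not (W v) ⟧
    intoA outOfA : Fin n → Fin n → ℕ
    intoA  u v = if does (v ≟ a) then ⟦ D u a ∧ Z u ⟧ else 0
    outOfA u v = if does (u ≟ a) then ⟦ D a v ∧ not (Z v) ⟧ else 0
    exchange : ∀ u v → crosses Z u v + intoA u v ≡ crosses (remove a Z) u v + outOfA u v
    exchange u v with u ≟ a | v ≟ a
    ... | yes refl | yes refl rewrite loopless u = refl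
    ... | yes refl | no _     rewrite Za | ∧-zeroʳ (D u v) = +-identityʳ _
    ... | no _     | yes refl
      rewrite Za | ∧-zeroʳ (Z u) | ∧-zeroʳ (D u v) | ∧-identityʳ (Z u ∧ true) | ∧-identityʳ (Z u) = sym (+-identityʳ _)
    ... | no _     | no _     rewrite ∧-identityʳ (Z u) | ∧-identityʳ (Z v) = refl

  arcsOutOf≤outdeg : ∀ a Y → arcsOutOf D a Y ≤ outdeg D a
  arcsOutOf≤outdeg a Y = ∑-mono (λ v → ⟦∧⟧≤ (D a v) (Y v))

  cut≤outVolume : ∀ Z → cut D Z ≤ outVolume D Z
  cut≤outVolume Z = ∑-mono row
    where
    row : ∀ u → ∑ (λ v → ⟦ D u v ∧ Z u ∧ not (Z v) ⟧) ≤ (if Z u then outdeg D u else 0)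
    row u with Z u
    ... | true  = arcsOutOf≤outdeg u (∁ Z)
    ... | false = ≤-reflexive (trans (∑-cong (λ v → cong ⟦_⟧ (∧-zeroʳ (D u v)))) (∑-zero n))

  cut-independent : ∀ Z → Independent D Z → cut D Z ≡ outVolume D Z
  cut-independent Z indep = ∑-cong row
    where
    row : ∀ u → ∑ (λ v → ⟦ D u v ∧ Z u ∧ not (Z v) ⟧) ≡ (if Z u then outdeg D u else 0)
    row u with Z u in Zu
    ... | true  = ∑-cong arc
      where
      arc : ∀ v → ⟦ D u v ∧ not (Z v) ⟧ ≡ ⟦ D u v ⟧
      arc v with Z v in Zv
      ... | false = cong ⟦_⟧ (∧-identityʳ (D u v))
      ... | true  rewrite indep u v Zu Zv = refl
    ... | false = trans (∑-cong (λ v → cong ⟦_⟧ (∧-zeroʳ (D u v)))) (∑-zero n)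

module _ {n} {D : Digraph n} (deg : MaxDegree2 D) where
  open MaxDegree2 deg

  cut-remove-sink : ∀ a Z → Z a ≡ true → outdeg D a ≡ 0 → cut D Z ≤ cut D (remove a Z)
  cut-remove-sink a Z Za out≡0 = begin
    cut D Z                                   ≤⟨ m≤m+n (cut D Z) (arcsInto D Z a) ⟩
    cut D Z + arcsInto D Z a                  ≡⟨ cut-remove D loopless a Z Za ⟩
    cut D (remove a Z) + arcsOutOf D a (∁ Z)  ≤⟨ +-monoʳ-≤ _ (≤-trans (arcsOutOf≤outdeg D a (∁ Z)) (≤-reflexive out≡0)) ⟩
    cut D (remove a Z) + 0                    ≡⟨ +-identityʳ _ ⟩
    cut D (remove a Z)                        ∎
    where open ≤-Reasoning

  cut-remove-head : ∀ u w Z → Z u ≡ true → Z w ≡ true → D u w ≡ true → cut D Z ≤ cut D (remove w Z)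
  cut-remove-head u w Z Zu Zw uw = +-cancelʳ-≤ 1 (cut D Z) (cut D (remove w Z)) (begin
    cut D Z + 1                               ≤⟨ +-monoʳ-≤ (cut D Z) into≥1 ⟩
    cut D Z + arcsInto D Z w                  ≡⟨ cut-remove D loopless w Z Zw ⟩
    cut D (remove w Z) + arcsOutOf D w (∁ Z)  ≤⟨ +-monoʳ-≤ _ (≤-trans (arcsOutOf≤outdeg D w (∁ Z)) out≤1) ⟩
    cut D (remove w Z) + 1                    ∎)
    where
    open ≤-Reasoning
    into≥1 : 1 ≤ arcsInto D Z w
    into≥1 = ≤-trans (≤-reflexive (cong₂ (λ x y → ⟦ x ∧ y ⟧) (sym uw) (sym Zu))) (∑-term≤ _ u)
    in≥1 : 1 ≤ indeg D w
    in≥1 = ≤-trans (≤-reflexive (cong ⟦_⟧ (sym uw))) (∑-term≤ _ u)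
    out≤1 : outdeg D w ≤ 1
    out≤1 = +-cancelʳ-≤ 1 (outdeg D w) 1 (≤-trans (+-monoʳ-≤ (outdeg D w) in≥1) (degree≤2 w))

  cut-insert-source : ∀ a Z → Z a ≡ false → indeg D a ≡ 0 →
                      cut D (insert a Z) ≡ cut D Z + arcsOutOf D a (∁ (insert a Z))
  cut-insert-source a Z Za in≡0 = begin
    cut D (insert a Z)                                        ≡⟨ sym (+-identityʳ _) ⟩
    cut D (insert a Z) + 0                                    ≡⟨ cong (cut D (insert a Z) +_) (sym into≡0) ⟩
    cut D (insert a Z) + arcsInto D (insert a Z) a
      ≡⟨ cut-remove D loopless a (insert a Z) (insert-∈ a Z) ⟩
    cut D (remove a (insert a Z)) + arcsOutOf D a (∁ (insert a Z))
      ≡⟨ cong (_+ arcsOutOf D a (∁ (insert a Z))) (cut-cong D (remove-insert a Z Za)) ⟩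
    cut D Z + arcsOutOf D a (∁ (insert a Z))                  ∎
    where
    open ≡-Reasoning
    into≡0 : arcsInto D (insert a Z) a ≡ 0
    into≡0 = n≤0⇒n≡0 (≤-trans (∑-mono (λ u → ⟦∧⟧≤ (D u a) _)) (≤-reflexive in≡0))

  cut≤cut-insert-source : ∀ a Z → Z a ≡ false → indeg D a ≡ 0 → cut D Z ≤ cut D (insert a Z)
  cut≤cut-insert-source a Z Za in≡0 = ≤-trans (m≤m+n _ _) (≤-reflexive (sym (cut-insert-source a Z Za in≡0)))

  outVolume≤∣∣+∣∣ : ∀ Z → outVolume D Z ≤ ∣ Z ∣ + ∣ Z ∣
  outVolume≤∣∣+∣∣ Z = ≤-trans (∑-mono term) (≤-reflexive (∑-distrib-+ (λ u → ⟦ Z u ⟧) (λ u → ⟦ Z u ⟧)))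
    where
    term : ∀ u → (if Z u then outdeg D u else 0) ≤ ⟦ Z u ⟧ + ⟦ Z u ⟧
    term u with Z u
    ... | true  = outdeg≤2 u
    ... | false = z≤n

  outVolume≤∣∣+∣fullOut∣ : ∀ Z → outVolume D Z ≤ ∣ Z ∣ + ∣ fullOut D ∣
  outVolume≤∣∣+∣fullOut∣ Z =
    ≤-trans (∑-mono term) (≤-reflexive (∑-distrib-+ (λ u → ⟦ Z u ⟧) (λ u → ⟦ fullOut D u ⟧)))
    where
    term : ∀ u → (if Z u then outdeg D u else 0) ≤ ⟦ Z u ⟧ + ⟦ fullOut D u ⟧
    term u with Z u
    ... | true  = ≤2⇒≤1+⟦≡ᵇ2⟧ (outdeg D u) (outdeg≤2 u)
    ... | false = z≤n

  outVolume-fullOut : ∀ P → P ⊆ fullOut D → outVolume D P ≡ ∣ P ∣ + ∣ P ∣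
  outVolume-fullOut P P⊆full = trans (∑-cong term) (∑-distrib-+ (λ u → ⟦ P u ⟧) (λ u → ⟦ P u ⟧))
    where
    term : ∀ u → (if P u then outdeg D u else 0) ≡ ⟦ P u ⟧ + ⟦ P u ⟧
    term u with P u in Pu
    ... | true  = ≡ᵇ2⇒≡2 _ (P⊆full u Pu)
    ... | false = refl

  outVolume-⊇fullOut : ∀ P → (∀ v → P v ≡ true → 1 ≤ outdeg D v) → fullOut D ⊆ P →
                       outVolume D P ≡ ∣ P ∣ + ∣ fullOut D ∣
  outVolume-⊇fullOut P out≥1 full⊆P =
    trans (∑-cong term) (∑-distrib-+ (λ u → ⟦ P u ⟧) (λ u → ⟦ fullOut D u ⟧))
    where
    term : ∀ u → (if P u then outdeg D u else 0) ≡ ⟦ P u ⟧ + ⟦ fullOut D u ⟧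
    term u with P u in Pu
    ... | true  = 1≤≤2⇒≡1+⟦≡ᵇ2⟧ (outdeg D u) (out≥1 u Pu) (outdeg≤2 u)
    ... | false with fullOut D u in full
    ...   | false = refl
    ...   | true  = case trans (sym (full⊆P u full)) Pu of λ ()

-- Source sides

record SourceSide {n} (D : Digraph n) (X : Subset n) : Set where
  field
    independent : Independent D X
    outdeg≥1    : ∀ v → X v ≡ true → 1 ≤ outdeg D v
    fullOut⊆    : fullOut D ⊆ X

sourceSide-optimal : ∀ {n} {D : Digraph n} {X : Subset n} → MaxDegree2 D → SourceSide D X →
                     ∀ P Z → P ⊆ X → P ⊆ fullOut D ⊎ fullOut D ⊆ P → ∣ Z ∣ ≡ ∣ P ∣ → cut D Z ≤ cut D P
sourceSide-optimal {D = D} deg side P Z P⊆X P≶full ∣Z∣≡∣P∣ = begin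
  cut D Z        ≤⟨ cut≤outVolume D Z ⟩
  outVolume D Z  ≤⟨ bound P≶full ⟩
  outVolume D P  ≡⟨ sym (cut-independent D P (λ u v Pu Pv → independent u v (P⊆X u Pu) (P⊆X v Pv))) ⟩
  cut D P        ∎
  where
  open ≤-Reasoning
  open SourceSide side
  bound : P ⊆ fullOut D ⊎ fullOut D ⊆ P → outVolume D Z ≤ outVolume D P
  bound (inj₁ P⊆full) = begin
    outVolume D Z    ≤⟨ outVolume≤∣∣+∣∣ deg Z ⟩
    ∣ Z ∣ + ∣ Z ∣    ≡⟨ cong₂ _+_ ∣Z∣≡∣P∣ ∣Z∣≡∣P∣ ⟩
    ∣ P ∣ + ∣ P ∣    ≡⟨ sym (outVolume-fullOut deg P P⊆full) ⟩
    outVolume D P    ∎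
  bound (inj₂ full⊆P) = begin
    outVolume D Z              ≤⟨ outVolume≤∣∣+∣fullOut∣ deg Z ⟩
    ∣ Z ∣ + ∣ fullOut D ∣      ≡⟨ cong (_+ ∣ fullOut D ∣) ∣Z∣≡∣P∣ ⟩
    ∣ P ∣ + ∣ fullOut D ∣      ≡⟨ sym (outVolume-⊇fullOut deg P (λ v Pv → outdeg≥1 v (P⊆X v Pv)) full⊆P) ⟩
    outVolume D P              ∎

module _ {n} {D : Digraph n} (deg : MaxDegree2 D) where
  open MaxDegree2 deg

  arc-ends-distinct : ∀ {u w} → D u w ≡ true → u ≢ w
  arc-ends-distinct {u} uw refl = case trans (sym uw) (loopless u) of λ ()

  maximum-absorbs-out-neighbours : ∀ {X s w} → (∀ Z → cut D Z ≤ cut D X) → X s ≡ false → indeg D s ≡ 0 →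
                                   D s w ≡ true → X w ≡ true
  maximum-absorbs-out-neighbours {X} {s} {w} maximum Xs in≡0 sw = Bool.¬-not λ Xw →
    <⇒≱ (cut-grows Xw) (maximum (insert s X))
    where
    cut-grows : X w ≡ false → cut D X < cut D (insert s X)
    cut-grows Xw = begin-strict
      cut D X                                   <⟨ m<m+n (cut D X) arc-leaves ⟩
      cut D X + arcsOutOf D s (∁ (insert s X))  ≡⟨ sym (cut-insert-source deg s X Xs in≡0) ⟩
      cut D (insert s X)                        ∎
      where
      open ≤-Reasoning
      w∉insert : insert s X w ≡ false
      w∉insert with w ≟ s
      ... | yes w≡s = ⊥-elim (arc-ends-distinct sw (sym w≡s))
      ... | no _    = trans (∨-identityʳ (X w)) Xw
      arc-leaves : 1 ≤ arcsOutOf D s (∁ (insert s X))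
      arc-leaves = ≤-trans (≤-reflexive (cong₂ (λ x y → ⟦ x ∧ not y ⟧) (sym sw) (sym w∉insert))) (∑-term≤ _ w)

  full-source-exchange : ∀ {X s} → (∀ Z → cut D Z ≤ cut D X) → X s ≡ false → outdeg D s ≡ 2 →
                         ∃ λ Z → Z ⊆ insert s X × cut D X ≤ cut D Z × suc ∣ Z ∣ ≡ ∣ X ∣
  full-source-exchange {X} {s} maximum Xs out≡2 with count-two-witnesses (D s) (≤-reflexive (sym out≡2))
  ... | w₁ , w₂ , w₁≢w₂ , sw₁ , sw₂ = Z , Z⊆X+s , cutX≤cutZ , ∣Z∣<∣X∣
    where
    X+s Y Z : Subset n
    X+s = insert s X
    Y   = remove w₁ X+s
    Z   = remove w₂ Y
    in≡0 : indeg D s ≡ 0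
    in≡0 = outdeg≡2⇒indeg≡0 s out≡2
    head∈X+s : ∀ {w} → D s w ≡ true → X+s w ≡ true
    head∈X+s sw = insert-⊇ s X _ (maximum-absorbs-out-neighbours maximum Xs in≡0 sw)
    s∈Y : Y s ≡ true
    s∈Y = remove-∈ w₁ X+s (insert-∈ s X) (arc-ends-distinct sw₁)
    w₂∈Y : Y w₂ ≡ true
    w₂∈Y = remove-∈ w₁ X+s (head∈X+s sw₂) (λ w₂≡w₁ → w₁≢w₂ (sym w₂≡w₁))
    Z⊆X+s : Z ⊆ X+s
    Z⊆X+s v Zv = remove-⊆ w₁ X+s v (remove-⊆ w₂ Y v Zv)
    cutX≤cutZ : cut D X ≤ cut D Z
    cutX≤cutZ = begin
      cut D X        ≤⟨ cut≤cut-insert-source deg s X Xs in≡0 ⟩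
      cut D X+s      ≤⟨ cut-remove-head deg s w₁ X+s (insert-∈ s X) (head∈X+s sw₁) sw₁ ⟩
      cut D Y        ≤⟨ cut-remove-head deg s w₂ Y s∈Y w₂∈Y sw₂ ⟩
      cut D Z        ∎
      where open ≤-Reasoning
    ∣Z∣<∣X∣ : suc ∣ Z ∣ ≡ ∣ X ∣
    ∣Z∣<∣X∣ = suc-injective (begin
      suc (suc ∣ Z ∣)  ≡⟨ cong suc (sym (∣remove∣ w₂ Y w₂∈Y)) ⟩
      suc ∣ Y ∣        ≡⟨ sym (∣remove∣ w₁ X+s (head∈X+s sw₁)) ⟩
      ∣ X+s ∣          ≡⟨ ∣insert∣ s X Xs ⟩
      suc ∣ X ∣        ∎)
      where open ≡-Reasoning

  minimalMaximum-sourceSide : ∀ (A X : Subset n) → X ⊆ A → fullOut D ⊆ A →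
                              (∀ Z → cut D Z ≤ cut D X) →
                              (∀ Z → Z ⊆ A → cut D X ≤ cut D Z → ∣ X ∣ ≤ ∣ Z ∣) →
                              SourceSide D X
  minimalMaximum-sourceSide A X X⊆A full⊆A maximum minimal = record
    { independent = independent
    ; outdeg≥1    = outdeg≥1
    ; fullOut⊆    = fullOut⊆
    }
    where
    no-smaller : ∀ Z → Z ⊆ A → cut D X ≤ cut D Z → suc ∣ Z ∣ ≤ ∣ X ∣ → ⊥
    no-smaller Z Z⊆A cutX≤cutZ ∣Z∣<∣X∣ = <⇒≱ ∣Z∣<∣X∣ (minimal Z Z⊆A cutX≤cutZ)

    no-smaller-remove : ∀ a → X a ≡ true → cut D X ≤ cut D (remove a X) → ⊥
    no-smaller-remove a Xa cutX≤ = no-smaller (remove a X) (λ v Xv → X⊆A v (remove-⊆ a X v Xv)) cutX≤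
                                     (≤-reflexive (sym (∣remove∣ a X Xa)))

    independent : Independent D X
    independent u w Xu Xw = Bool.¬-not λ uw → no-smaller-remove w Xw (cut-remove-head deg u w X Xu Xw uw)

    outdeg≥1 : ∀ v → X v ≡ true → 1 ≤ outdeg D v
    outdeg≥1 v Xv with outdeg D v in out
    ... | suc _ = s≤s z≤n
    ... | zero  = ⊥-elim (no-smaller-remove v Xv (cut-remove-sink deg v X Xv out))

    fullOut⊆ : fullOut D ⊆ X
    fullOut⊆ s full = Bool.¬-not λ Xs →
      let Z , Z⊆X+s , cutX≤cutZ , ∣Z∣<∣X∣ = full-source-exchange maximum Xs (≡ᵇ2⇒≡2 _ full)
      in no-smaller Z (λ v Zv → insert-⊆ s X A X⊆A (full⊆A s full) v (Z⊆X+s v Zv))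
                      cutX≤cutZ (≤-reflexive ∣Z∣<∣X∣)

cut-maximum : ∀ {n} (D : Digraph n) → ∃ λ X → ∀ Z → cut D Z ≤ cut D X
cut-maximum D =
  let X , _ , X-max = maximise {Q = λ _ → ⊤} (λ _ → yes tt) (λ _ _ → tt) (cut D) (cut-cong D) {λ _ → false} tt
  in X , λ Z → X-max Z tt

maximum-sourceSide-within : ∀ {n} {D : Digraph n} → MaxDegree2 D → ∀ A X₀ → X₀ ⊆ A → fullOut D ⊆ A →
                            (∀ Z → cut D Z ≤ cut D X₀) →
                            ∃ λ X → X ⊆ A × (∀ Z → cut D Z ≤ cut D X) × SourceSide D X
maximum-sourceSide-within {D = D} deg A X₀ X₀⊆A full⊆A X₀-max
  with minimise {Q = λ Z → Z ⊆ A × cut D Z ≡ cut D X₀}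
         (λ Z → Z ⊆? A ×-dec cut D Z ℕ.≟ cut D X₀)
         (λ Y≗Z (Y⊆A , cutY≡M) → ⊆-respˡ-≗ Y≗Z Y⊆A , trans (sym (cut-cong D Y≗Z)) cutY≡M)
         ∣_∣ ∣∣-cong (X₀⊆A , refl)
... | X , (X⊆A , cutX≡M) , X-smallest = X , X⊆A , X-maximum ,
  minimalMaximum-sourceSide deg A X X⊆A full⊆A X-maximum
    (λ Z Z⊆A cutX≤cutZ → X-smallest Z (Z⊆A , ≤-antisym (X₀-max Z) (subst (_≤ cut D Z) cutX≡M cutX≤cutZ)))
  where
  X-maximum : ∀ Z → cut D Z ≤ cut D X
  X-maximum Z = subst (cut D Z ≤_) (sym cutX≡M) (X₀-max Z)

fullIn⊆∁sourceSide : ∀ {n} {D : Digraph n} {X} → MaxDegree2 D → SourceSide D X → fullOut (reverse D) ⊆ ∁ X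
fullIn⊆∁sourceSide {D = D} {X} deg side v full = Bool.¬-not λ Xv → 1+n≰n (begin
  3                        ≡⟨ cong (1 +_) (sym (≡ᵇ2⇒≡2 _ full)) ⟩
  1 + indeg D v            ≤⟨ +-monoˡ-≤ (indeg D v) (SourceSide.outdeg≥1 side v (Bool.not-injective Xv)) ⟩
  outdeg D v + indeg D v   ≤⟨ MaxDegree2.degree≤2 deg v ⟩
  2                        ∎)
  where open ≤-Reasoning

record Bracket {n} (D : Digraph n) : Set where
  field
    sources sinks   : Subset n
    sources-maximum : ∀ Z → cut D Z ≤ cut D sources
    cut-∁sinks      : cut D (∁ sinks) ≡ cut D sources
    sinks⊆∁sources  : sinks ⊆ ∁ sources
    sources-side    : SourceSide D sources
    sinks-side      : SourceSide (reverse D) sinks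

bracket : ∀ {n} {D : Digraph n} → MaxDegree2 D → Bracket D
bracket {D = D} deg with cut-maximum D
... | X₀ , X₀-max with maximum-sourceSide-within deg (λ _ → true) X₀ (λ _ _ → refl) (λ _ _ → refl) X₀-max
... | X , _ , X-max , X-side with maximum-sourceSide-within (reverse-maxDegree2 deg) (∁ X) (∁ X)
                                   (λ _ ∁Xv → ∁Xv) (fullIn⊆∁sourceSide deg X-side) (reverse-∁-maximum D X X-max)
... | Y , Y⊆∁X , Y-max , Y-side = record
  { sources         = X
  ; sinks           = Y
  ; sources-maximum = X-max
  ; cut-∁sinks      = ≤-antisym (X-max (∁ Y)) (begin
      cut D X                ≡⟨ sym (cut-reverse-∁ D X) ⟩
      cut (reverse D) (∁ X)  ≤⟨ Y-max (∁ X) ⟩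
      cut (reverse D) Y      ≡⟨ cut-reverse D Y ⟩
      cut D (∁ Y)            ∎)
  ; sinks⊆∁sources  = Y⊆∁X
  ; sources-side    = X-side
  ; sinks-side      = Y-side
  }
  where open ≤-Reasoning

-- The layered arrangement

layer : (source full-out sink full-in : Bool) → ℕ
layer true  true  _     _     = 0
layer true  false _     _     = 1
layer false _     false _     = 2
layer false _     true  false = 3
layer false _     true  true  = 4

private
  variable
    x o y i : Bool

layer<1⇒full-out : layer x o y i < 1 → o ≡ true
layer<1⇒full-out {true}  {true}  _ = refl
layer<1⇒full-out {true}  {false} (s≤s ())
layer<1⇒full-out {false} {y = false} (s≤s ())
layer<1⇒full-out {false} {y = true} {false} (s≤s ())
layer<1⇒full-out {false} {y = true} {true}  (s≤s ())

layer<2⇒source : layer x o y i < 2 → x ≡ true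
layer<2⇒source {true} _ = refl
layer<2⇒source {false} {y = false} (s≤s (s≤s ()))
layer<2⇒source {false} {y = true} {false} (s≤s (s≤s ()))
layer<2⇒source {false} {y = true} {true}  (s≤s (s≤s ()))

layer<3⇒source⊎nonsink : layer x o y i < 3 → x ≡ true ⊎ y ≡ false
layer<3⇒source⊎nonsink {true} _ = inj₁ refl
layer<3⇒source⊎nonsink {false} {y = false} _ = inj₂ refl
layer<3⇒source⊎nonsink {false} {y = true} {false} (s≤s (s≤s (s≤s ())))
layer<3⇒source⊎nonsink {false} {y = true} {true}  (s≤s (s≤s (s≤s ())))

layer≮4⇒full-in : ¬ layer x o y i < 4 → i ≡ true
layer≮4⇒full-in {true}  {true}  ≮4 = ⊥-elim (≮4 (s≤s z≤n))
layer≮4⇒full-in {true}  {false} ≮4 = ⊥-elim (≮4 (s≤s (s≤s z≤n)))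
layer≮4⇒full-in {false} {y = false} ≮4 = ⊥-elim (≮4 (s≤s (s≤s (s≤s z≤n))))
layer≮4⇒full-in {false} {y = true} {false} ≮4 = ⊥-elim (≮4 (s≤s (s≤s (s≤s (s≤s z≤n)))))
layer≮4⇒full-in {false} {y = true} {true}  _  = refl

full-out-source⇒layer<1 : x ≡ true → o ≡ true → layer x o y i < 1
full-out-source⇒layer<1 refl refl = s≤s z≤n

source⇒layer<2 : x ≡ true → layer x o y i < 2
source⇒layer<2 {o = true}  refl = s≤s z≤n
source⇒layer<2 {o = false} refl = s≤s (s≤s z≤n)

nonsink⇒layer<3 : y ≡ false → layer x o y i < 3
nonsink⇒layer<3 {x = true}  {o = true}  refl = s≤s z≤n
nonsink⇒layer<3 {x = true}  {o = false} refl = s≤s (s≤s z≤n)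
nonsink⇒layer<3 {x = false}             refl = s≤s (s≤s (s≤s z≤n))

full-in-sink⇒layer≡4 : x ≡ false → y ≡ true → i ≡ true → layer x o y i ≡ 4
full-in-sink⇒layer≡4 refl refl refl = refl

module _ {n} {D : Digraph n} (deg : MaxDegree2 D) (B : Bracket D) where
  open Bracket B
  open SourceSide

  source⇒nonsink : ∀ v → sources v ≡ true → sinks v ≡ false
  source⇒nonsink v source = Bool.¬-not λ sink →
    case trans (sym (sinks⊆∁sources v sink)) (cong not source) of λ ()

  rank : Fin n → ℕ
  rank v = layer (sources v) (fullOut D v) (sinks v) (fullOut (reverse D) v)

  open RankBy rank

  prefix-optimal : ∀ k → k ≤ n → ∀ Z → ∣ Z ∣ ≡ k → cut D Z ≤ cut D (prefix arrangement k)
  prefix-optimal k k≤n Z ∣Z∣≡k = optimal (prefix-comparable k 2) (prefix-comparable k 3)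
    where
    P : Subset n
    P = prefix arrangement k
    P⊆rank< rank<⊆P : ℕ → Set
    P⊆rank< j = ∀ v → P v ≡ true → rank v < j
    rank<⊆P j = ∀ v → rank v < j → P v ≡ true
    ∣Z∣≡∣P∣ : ∣ Z ∣ ≡ ∣ P ∣
    ∣Z∣≡∣P∣ = trans ∣Z∣≡k (sym (∣prefix∣ arrangement k k≤n))

    source-case : P⊆rank< 2 → cut D Z ≤ cut D P
    source-case P⊆rank<2 = sourceSide-optimal deg sources-side P Z
      (λ v Pv → layer<2⇒source (P⊆rank<2 v Pv)) P≶fullOut ∣Z∣≡∣P∣
      where
      P≶fullOut : P ⊆ fullOut D ⊎ fullOut D ⊆ P
      P≶fullOut with prefix-comparable k 1
      ... | inj₁ P⊆rank<1 = inj₁ λ v Pv → layer<1⇒full-out (P⊆rank<1 v Pv)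
      ... | inj₂ rank<1⊆P = inj₂ λ v full →
              rank<1⊆P v (full-out-source⇒layer<1 (fullOut⊆ sources-side v full) full)

    middle-case : rank<⊆P 2 → P⊆rank< 3 → cut D Z ≤ cut D P
    middle-case rank<2⊆P P⊆rank<3 = ≤-trans (sources-maximum Z)
      (cut-sandwich D sources P (∁ sinks) sources-maximum refl cut-∁sinks sources⊆P P⊆∁sinks)
      where
      sources⊆P : sources ⊆ P
      sources⊆P v source = rank<2⊆P v (source⇒layer<2 source)
      P⊆∁sinks : P ⊆ ∁ sinks
      P⊆∁sinks v Pv with layer<3⇒source⊎nonsink (P⊆rank<3 v Pv)
      ... | inj₁ source  = cong not (source⇒nonsink v source)
      ... | inj₂ nonsink = cong not nonsink

    sink-case : rank<⊆P 3 → cut D Z ≤ cut D P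
    sink-case rank<3⊆P = begin
      cut D Z                    ≡⟨ sym (cut-reverse-∁ D Z) ⟩
      cut (reverse D) (∁ Z)      ≤⟨ sourceSide-optimal (reverse-maxDegree2 deg) sinks-side (∁ P) (∁ Z)
                                      ∁P⊆sinks ∁P≶fullIn (∣∁∣-cong {Y = Z} {P} ∣Z∣≡∣P∣) ⟩
      cut (reverse D) (∁ P)      ≡⟨ cut-reverse-∁ D P ⟩
      cut D P                    ∎
      where
      open ≤-Reasoning
      ∁P⊆sinks : ∁ P ⊆ sinks
      ∁P⊆sinks v ∁Pv = Bool.¬-not λ nonsink →
        case trans (sym ∁Pv) (cong not (rank<3⊆P v (nonsink⇒layer<3 nonsink))) of λ ()
      ∁P≶fullIn : ∁ P ⊆ fullOut (reverse D) ⊎ fullOut (reverse D) ⊆ ∁ P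
      ∁P≶fullIn with prefix-comparable k 4
      ... | inj₂ rank<4⊆P = inj₁ λ v ∁Pv → layer≮4⇒full-in λ rank<4 →
              case trans (sym ∁Pv) (cong not (rank<4⊆P v rank<4)) of λ ()
      ... | inj₁ P⊆rank<4 = inj₂ fullIn⊆∁P
        where
        fullIn⊆∁P : fullOut (reverse D) ⊆ ∁ P
        fullIn⊆∁P v full with P v in Pv
        ... | false = refl
        ... | true  = ⊥-elim (<-irrefl (full-in-sink⇒layer≡4 nonsource sink full) (P⊆rank<4 v Pv))
          where
          sink : sinks v ≡ true
          sink = fullOut⊆ sinks-side v full
          nonsource : sources v ≡ false
          nonsource = Bool.not-injective (sinks⊆∁sources v sink)

    optimal : P⊆rank< 2 ⊎ rank<⊆P 2 → P⊆rank< 3 ⊎ rank<⊆P 3 → cut D Z ≤ cut D P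
    optimal (inj₁ P⊆rank<2) _               = source-case P⊆rank<2
    optimal (inj₂ rank<2⊆P) (inj₁ P⊆rank<3) = middle-case rank<2⊆P P⊆rank<3
    optimal (inj₂ _)        (inj₂ rank<3⊆P) = sink-case rank<3⊆P

  maximumArrangement : IsMaximumArrangement D arrangement
  maximumArrangement k _ k<n =
    (prefix arrangement k , ∣prefix∣ arrangement k k≤n , refl) ,
    λ Z ∣Z∣≡k → prefix-optimal k k≤n Z ∣Z∣≡k
    where
    k≤n : k ≤ n
    k≤n = <⇒≤ k<n

mainTheorem18 : (n : ℕ) (G : Graph n) (D : Digraph n) →
    MaxDegreeAtMost G 2 → IsOrientation D G →
    Σ (Arrangement n) (λ π → IsMaximumArrangement D π)
mainTheorem18 n G D Δ≤2 orientation =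
  RankBy.arrangement (rank deg (bracket deg)) , maximumArrangement deg (bracket deg)
  where
  deg : MaxDegree2 D
  deg = orientation-maxDegree2 G D Δ≤2 orientation
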